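{- For every $\mathrm{LRP}$ formula $\phi$ there is a monadic second-order sentence $\mathrm{Tr}(\phi)$ such that for every graph $S$, $S\models\phi$ if and only if $S\models\mathrm{Tr}(\phi)$.
   Context: A vocabulary is $\tau=\langle C,U,F\rangle$ ($C$ finite set of constants, $U$ unary relation symbols, $F$ finite set of binary relation symbols). A graph over $\tau$ is $G=\langle V,E,C^G,U^G\rangle$ with $E(f)\subseteq V\times V$, $C^G(c)\in V$, $U^G(u)\subseteq V$. Atomic formulas are $t=t'$, $u(t)$, $t\xrightarrow{f}t'$ over variables and constants; quantifier-free formulas are their Boolean combinations. Routing expressions: $R::=\emptyset\mid\epsilon\mid \xrightarrow{f}\mid \xleftarrow{f}\mid u\mid\neg u\mid c\mid \neg c\mid R_1.R_2\mid R_1|R_2\mid R^*$, with language $L(R)$. A path labelled by a word from $a$ to $b$: $\epsilon$: $a=b$; $\xrightarrow{f}$: $(a,b)\in E(f)$; $\xleftarrow{f}$: $(b,a)\in E(f)$; $u$: $a=b\in U^G(u)$; $\neg u$: $a=b\notin U^G(u)$; $c$: $a=b=C^G(c)$; $\neg c$: $a=b\ne C^G(c)$; concatenation composes paths. An $R$-path is a path labelled by a word of $L(R)$. A neighborhood formula $N(v_0,\dots,v_n)$ is a conjunction of edge atoms $v_i\xrightarrow{f}v_j$. A reachability constraint is a closed formula $\forall v_0,\dots,v_n.\ R(c,v_0)\Rightarrow(N(v_0,\dots,v_n)\Rightarrow\psi(v_0,\dots,v_n))$ with $c\in C$, $N$ a neighborhood formula, $\psi$ quantifier-free, $FV(N)\subseteq\{v_0,\dots,v_n\}$,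 $FV(\psi)\subseteq FV(N)\cup\{v_0\}$; $G$ satisfies it iff for every node $a$ reachable from $C^G(c)$ by an $R$-path and every assignment of nodes to the variables with $v_0\mapsto a$, $N\Rightarrow\psi$ holds. An $\mathrm{LRP}$ formula is a Boolean combination of reachability constraints. -}

module Defs where

open import Level using (Level; Lift; lift; 0ℓ) renaming (suc to lsuc)
open import Data.Nat using (ℕ; suc)
open import Data.Fin using (Fin; zero)
open import Data.List using (List; []; _∷_; [_]; _++_)
open import Data.List.Relation.Unary.All using (All)
open import Data.List.Relation.Unary.Any using (Any)
open import Data.Product using (Σ; _×_; _,_)
open import Data.Sum using (_⊎_)
open import Data.Empty using (⊥)
open import Relation.Nullary using (¬_)
open import Relation.Binary.PropositionalEquality using (_≡_)

record Vocab : Set₁ where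
  field
    nC : ℕ
    Unary : Set
    nF : ℕ

open Vocab public

Const : Vocab → Set
Const τ = Fin (nC τ)

Bin : Vocab → Set
Bin τ = Fin (nF τ)

record Graph (τ : Vocab) : Set₁ where
  field
    V  : Set
    E  : Bin τ → V → V → Set
    Cᴳ : Const τ → V
    Uᴳ : Unary τ → V → Set

open Graph public

data RExp (τ : Vocab) : Set where
  ∅ᴿ εᴿ   : RExp τ
  ⟶ᴿ ⟵ᴿ  : Bin τ → RExp τ
  uᴿ ¬uᴿ  : Unary τ → RExp τ
  cᴿ ¬cᴿ  : Const τ → RExp τ
  _·ᴿ_ _∣ᴿ_ : RExp τ → RExp τ → RExp τ
  _⋆ᴿ     : RExp τ → RExp τ

data Letter (τ : Vocab) : Set where
  ⟶ ⟵   : Bin τ → Letter τ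
  is ¬is : Unary τ → Letter τ
  isc ¬isc : Const τ → Letter τ

Word : Vocab → Set
Word τ = List (Letter τ)

data _∈L_ {τ : Vocab} : Word τ → RExp τ → Set where
  ε∈   : [] ∈L εᴿ
  ⟶∈   : ∀ f → [ ⟶ f ] ∈L ⟶ᴿ f
  ⟵∈   : ∀ f → [ ⟵ f ] ∈L ⟵ᴿ f
  u∈   : ∀ u → [ is u ] ∈L uᴿ u
  ¬u∈  : ∀ u → [ ¬is u ] ∈L ¬uᴿ u
  c∈   : ∀ c → [ isc c ] ∈L cᴿ c
  ¬c∈  : ∀ c → [ ¬isc c ] ∈L ¬cᴿ c
  ·∈   : ∀ {w₁ w₂ R₁ R₂} → w₁ ∈L R₁ → w₂ ∈L R₂ → (w₁ ++ w₂) ∈L (R₁ ·ᴿ R₂)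
  ∣∈ˡ  : ∀ {w R₁ R₂} → w ∈L R₁ → w ∈L (R₁ ∣ᴿ R₂)
  ∣∈ʳ  : ∀ {w R₁ R₂} → w ∈L R₂ → w ∈L (R₁ ∣ᴿ R₂)
  ⋆∈[] : ∀ {R} → [] ∈L (R ⋆ᴿ)
  ⋆∈++ : ∀ {w₁ w₂ R} → w₁ ∈L R → w₂ ∈L (R ⋆ᴿ) → (w₁ ++ w₂) ∈L (R ⋆ᴿ)

LetterStep : ∀ {τ} (G : Graph τ) → V G → Letter τ → V G → Set
LetterStep G a (⟶ f)    b = E G f a b
LetterStep G a (⟵ f)    b = E G f b a
LetterStep G a (is u)   b = a ≡ b × Uᴳ G u a
LetterStep G a (¬is u)  b = a ≡ b × ¬ Uᴳ G u a
LetterStep G a (isc c)  b = a ≡ b × a ≡ Cᴳ G c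
LetterStep G a (¬isc c) b = a ≡ b × ¬ (a ≡ Cᴳ G c)

data PathW {τ} (G : Graph τ) : V G → Word τ → V G → Set where
  nil  : ∀ a → PathW G a [] a
  step : ∀ {a b c ℓ w} → LetterStep G a ℓ b → PathW G b w c → PathW G a (ℓ ∷ w) c

RPath : ∀ {τ} (G : Graph τ) → RExp τ → V G → V G → Set
RPath {τ} G R a b = Σ (Word τ) λ w → w ∈L R × PathW G a w b

data Term (τ : Vocab) (n : ℕ) : Set where
  var : Fin n → Term τ n
  con : Const τ → Term τ n

data QF (τ : Vocab) (n : ℕ) : Set where
  _≐_   : Term τ n → Term τ n → QF τ n
  un    : Unary τ → Term τ n → QF τ n
  edge  : Bin τ → Term τ n → Term τ n → QF τ n
  ¬q    : QF τ n → QF τ n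
  _∧q_ _∨q_ : QF τ n → QF τ n → QF τ n

⟦_⟧ᵗ : ∀ {τ n} {G : Graph τ} → Term τ n → (Fin n → V G) → V G
⟦ var i ⟧ᵗ ρ = ρ i
⟦_⟧ᵗ {G = G} (con c) ρ = Cᴳ G c

⟦_⟧q : ∀ {τ n} {G : Graph τ} → QF τ n → (Fin n → V G) → Set
⟦_⟧q {G = G} (t ≐ t')    ρ = ⟦_⟧ᵗ {G = G} t ρ ≡ ⟦_⟧ᵗ {G = G} t' ρ
⟦_⟧q {G = G} (un u t)    ρ = Uᴳ G u (⟦_⟧ᵗ {G = G} t ρ)
⟦_⟧q {G = G} (edge f t t') ρ = E G f (⟦_⟧ᵗ {G = G} t ρ) (⟦_⟧ᵗ {G = G} t' ρ)
⟦_⟧q {G = G} (¬q ψ)      ρ = ¬ ⟦_⟧q {G = G} ψ ρ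
⟦_⟧q {G = G} (ψ ∧q χ)    ρ = ⟦_⟧q {G = G} ψ ρ × ⟦_⟧q {G = G} χ ρ
⟦_⟧q {G = G} (ψ ∨q χ)    ρ = ⟦_⟧q {G = G} ψ ρ ⊎ ⟦_⟧q {G = G} χ ρ

data _∈FVᵗ_ {τ n} (i : Fin n) : Term τ n → Set where
  here : i ∈FVᵗ var i

data _∈FVq_ {τ n} (i : Fin n) : QF τ n → Set where
  ≐ˡ   : ∀ {t t'} → i ∈FVᵗ t → i ∈FVq (t ≐ t')
  ≐ʳ   : ∀ {t t'} → i ∈FVᵗ t' → i ∈FVq (t ≐ t')
  un∈  : ∀ {u t} → i ∈FVᵗ t → i ∈FVq un u t
  edgeˡ : ∀ {f t t'} → i ∈FVᵗ t → i ∈FVq edge f t t'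
  edgeʳ : ∀ {f t t'} → i ∈FVᵗ t' → i ∈FVq edge f t t'
  ¬∈   : ∀ {ψ} → i ∈FVq ψ → i ∈FVq ¬q ψ
  ∧ˡ   : ∀ {ψ χ} → i ∈FVq ψ → i ∈FVq (ψ ∧q χ)
  ∧ʳ   : ∀ {ψ χ} → i ∈FVq χ → i ∈FVq (ψ ∧q χ)
  ∨ˡ   : ∀ {ψ χ} → i ∈FVq ψ → i ∈FVq (ψ ∨q χ)
  ∨ʳ   : ∀ {ψ χ} → i ∈FVq χ → i ∈FVq (ψ ∨q χ)

Nbhd : Vocab → ℕ → Set
Nbhd τ n = List (Fin n × Bin τ × Fin n)

_∈FVN_ : ∀ {τ n} → Fin n → Nbhd τ n → Set
i ∈FVN N = Any (λ { (j , f , k) → i ≡ j ⊎ i ≡ k }) N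

⟦_⟧N : ∀ {τ n} {G : Graph τ} → Nbhd τ n → (Fin n → V G) → Set
⟦_⟧N {G = G} N ρ = All (λ { (j , f , k) → E G f (ρ j) (ρ k) }) N

-- Reachability constraints
--   ∀ v₀ … vₙ. R(c, v₀) ⇒ (N(v₀,…,vₙ) ⇒ ψ(v₀,…,vₙ))
-- variables v₀ … vₙ are Fin (suc n), v₀ = zero

record ReachConstraint (τ : Vocab) : Set where
  constructor reach
  field
    n  : ℕ
    c  : Const τ
    R  : RExp τ
    N  : Nbhd τ (suc n)
    ψ  : QF τ (suc n)
    fv : ∀ (i : Fin (suc n)) → _∈FVq_ {τ} i ψ → _∈FVN_ {τ} i N ⊎ i ≡ zero

_⊨RC_ : ∀ {τ} → Graph τ → ReachConstraint τ → Set
G ⊨RC reach n c R N ψ fv =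
  ∀ (a : V G) → RPath G R (Cᴳ G c) a →
  ∀ (ρ : Fin (suc n) → V G) → ρ zero ≡ a →
  ⟦_⟧N {G = G} N ρ → ⟦_⟧q {G = G} ψ ρ

data LRP (τ : Vocab) : Set where
  rc   : ReachConstraint τ → LRP τ
  ¬ₗ   : LRP τ → LRP τ
  _∧ₗ_ _∨ₗ_ : LRP τ → LRP τ → LRP τ

_⊨_ : ∀ {τ} → Graph τ → LRP τ → Set
G ⊨ rc r    = G ⊨RC r
G ⊨ ¬ₗ φ    = ¬ (G ⊨ φ)
G ⊨ (φ ∧ₗ χ) = (G ⊨ φ) × (G ⊨ χ)
G ⊨ (φ ∨ₗ χ) = (G ⊨ φ) ⊎ (G ⊨ χ)

-- Monadic second-order logic over τ
-- MSO τ m k : formulas with first-order variables Fin m, set variables Fin k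

data MSO (τ : Vocab) : ℕ → ℕ → Set where
  _≐ₘ_  : ∀ {m k} → Term τ m → Term τ m → MSO τ m k
  unₘ   : ∀ {m k} → Unary τ → Term τ m → MSO τ m k
  edgeₘ : ∀ {m k} → Bin τ → Term τ m → Term τ m → MSO τ m k
  _∈ₘ_  : ∀ {m k} → Term τ m → Fin k → MSO τ m k
  ¬ₘ    : ∀ {m k} → MSO τ m k → MSO τ m k
  _∧ₘ_ _∨ₘ_ _⇒ₘ_ : ∀ {m k} → MSO τ m k → MSO τ m k → MSO τ m k
  ∃₁ ∀₁ : ∀ {m k} → MSO τ (suc m) k → MSO τ m k
  ∃₂ ∀₂ : ∀ {m k} → MSO τ m (suc k) → MSO τ m k

extend : ∀ {a} {A : Set a} {n} → A → (Fin n → A) → Fin (suc n) → A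
extend x ρ zero = x
extend x ρ (Data.Fin.suc i) = ρ i

⟦_⟧ₘ : ∀ {τ m k} {G : Graph τ} → MSO τ m k →
       (Fin m → V G) → (Fin k → (V G → Set)) → Set₁
⟦_⟧ₘ {G = G} (t ≐ₘ t') ρ σ = Lift _ (⟦_⟧ᵗ {G = G} t ρ ≡ ⟦_⟧ᵗ {G = G} t' ρ)
⟦_⟧ₘ {G = G} (unₘ u t) ρ σ = Lift _ (Uᴳ G u (⟦_⟧ᵗ {G = G} t ρ))
⟦_⟧ₘ {G = G} (edgeₘ f t t') ρ σ = Lift _ (E G f (⟦_⟧ᵗ {G = G} t ρ) (⟦_⟧ᵗ {G = G} t' ρ))
⟦_⟧ₘ {G = G} (t ∈ₘ X) ρ σ = Lift _ (σ X (⟦_⟧ᵗ {G = G} t ρ))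
⟦_⟧ₘ {G = G} (¬ₘ θ) ρ σ = ¬ ⟦_⟧ₘ {G = G} θ ρ σ
⟦_⟧ₘ {G = G} (θ ∧ₘ χ) ρ σ = ⟦_⟧ₘ {G = G} θ ρ σ × ⟦_⟧ₘ {G = G} χ ρ σ
⟦_⟧ₘ {G = G} (θ ∨ₘ χ) ρ σ = ⟦_⟧ₘ {G = G} θ ρ σ ⊎ ⟦_⟧ₘ {G = G} χ ρ σ
⟦_⟧ₘ {G = G} (θ ⇒ₘ χ) ρ σ = ⟦_⟧ₘ {G = G} θ ρ σ → ⟦_⟧ₘ {G = G} χ ρ σ
⟦_⟧ₘ {G = G} (∃₁ θ) ρ σ = Σ (Lift (lsuc 0ℓ) (V G)) λ { (lift a) → ⟦_⟧ₘ {G = G} θ (extend a ρ) σ }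
⟦_⟧ₘ {G = G} (∀₁ θ) ρ σ = ∀ (a : V G) → ⟦_⟧ₘ {G = G} θ (extend a ρ) σ
⟦_⟧ₘ {G = G} (∃₂ θ) ρ σ = Σ (V G → Set) λ X → ⟦_⟧ₘ {G = G} θ ρ (extend X σ)
⟦_⟧ₘ {G = G} (∀₂ θ) ρ σ = ∀ (X : V G → Set) → ⟦_⟧ₘ {G = G} θ ρ (extend X σ)

MSOSentence : Vocab → Set
MSOSentence τ = MSO τ 0 0

_⊨ₘ_ : ∀ {τ} → Graph τ → MSOSentence τ → Set₁
G ⊨ₘ θ = ⟦_⟧ₘ {G = G} θ (λ ()) (λ ())

-- A routing expression R becomes an MSO formula reach_R(x, y) by structural recursion:
-- letters become atomic formulas, concatenation an existential quantifier over the
-- midpoint, union a disjunction, and R* the usual MSO definition of reflexive-transitive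
-- closure: x lies in every set that contains y and is closed under R-predecessors.
-- A reachability constraint becomes the universal closure of reach_R(c, v₀) ⇒ (N ⇒ ψ),
-- and Boolean combinations are translated connective by connective.
module Submission where

open import Defs
open import Data.Product using (Σ)
open import Function.Bundles using (_⇔_)

open import Level using (Lift; lift; lower)
open import Data.Nat using (suc; zero)
open import Data.Fin using (Fin) renaming (zero to fzero; suc to fsuc)
open import Data.List using ([]; _∷_; [_]; _++_)
open import Data.List.Relation.Unary.All using ([]; _∷_)
open import Data.Product using (_×_; _,_; ∃-syntax)
open import Data.Sum using (_⊎_; inj₁; inj₂)
open import Data.Empty using (⊥-elim)
open import Relation.Nullary using (¬_)
open import Relation.Binary.PropositionalEquality
  using (_≡_; refl; sym; trans; subst; subst₂; _≗_)
open import Function.Bundles using (mk⇔; Equivalence)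
open import Function.Properties.Equivalence
  using () renaming (refl to ⇔-refl; sym to ⇔-sym; trans to ⇔-trans)
open import Data.Product.Function.NonDependent.Propositional using (_×-⇔_)
open import Data.Sum.Function.Propositional using (_⊎-⇔_)
open import Function.Related.TypeIsomorphisms using (¬-cong-⇔; →-cong-⇔)

open Equivalence using (to; from)

Lift-⇔ : ∀ {a ℓ} {A : Set a} → Lift ℓ A ⇔ A
Lift-⇔ = mk⇔ lower lift

∀-cong-⇔ : ∀ {a b c} {A : Set a} {P : A → Set b} {Q : A → Set c} →
           (∀ x → P x ⇔ Q x) → (∀ x → P x) ⇔ (∀ x → Q x)
∀-cong-⇔ P⇔Q = mk⇔ (λ h x → P⇔Q x .to (h x)) (λ h x → P⇔Q x .from (h x))

module _ {τ : Vocab} where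

  weaken : ∀ {m} → Term τ m → Term τ (suc m)
  weaken (var i) = var (fsuc i)
  weaken (con c) = con c

  letterExp : Letter τ → RExp τ
  letterExp (⟶ f)    = ⟶ᴿ f
  letterExp (⟵ f)    = ⟵ᴿ f
  letterExp (is u)   = uᴿ u
  letterExp (¬is u)  = ¬uᴿ u
  letterExp (isc c)  = cᴿ c
  letterExp (¬isc c) = ¬cᴿ c

  letterFormula : ∀ {m k} → Letter τ → Term τ m → Term τ m → MSO τ m k
  letterFormula (⟶ f)    x y = edgeₘ f x y
  letterFormula (⟵ f)    x y = edgeₘ f y x
  letterFormula (is u)   x y = (x ≐ₘ y) ∧ₘ unₘ u x
  letterFormula (¬is u)  x y = (x ≐ₘ y) ∧ₘ ¬ₘ (unₘ u x)
  letterFormula (isc c)  x y = (x ≐ₘ y) ∧ₘ (x ≐ₘ con c)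
  letterFormula (¬isc c) x y = (x ≐ₘ y) ∧ₘ ¬ₘ (x ≐ₘ con c)

  reachFormula : ∀ {m k} → RExp τ → Term τ m → Term τ m → MSO τ m k
  reachFormula ∅ᴿ         x y = ¬ₘ (x ≐ₘ x)
  reachFormula εᴿ         x y = x ≐ₘ y
  reachFormula (⟶ᴿ f)     x y = letterFormula (⟶ f) x y
  reachFormula (⟵ᴿ f)     x y = letterFormula (⟵ f) x y
  reachFormula (uᴿ u)     x y = letterFormula (is u) x y
  reachFormula (¬uᴿ u)    x y = letterFormula (¬is u) x y
  reachFormula (cᴿ c)     x y = letterFormula (isc c) x y
  reachFormula (¬cᴿ c)    x y = letterFormula (¬isc c) x y
  reachFormula (R₁ ·ᴿ R₂) x y =
    ∃₁ (reachFormula R₁ (weaken x) mid ∧ₘ reachFormula R₂ mid (weaken y))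
    where mid = var fzero
  reachFormula (R₁ ∣ᴿ R₂) x y = reachFormula R₁ x y ∨ₘ reachFormula R₂ x y
  reachFormula (R ⋆ᴿ)     x y = ∀₂ ((predClosed ∧ₘ (y ∈ₘ X)) ⇒ₘ (x ∈ₘ X))
    where
    X = fzero
    a = var (fsuc fzero)
    b = var fzero
    predClosed = ∀₁ (∀₁ ((reachFormula R a b ∧ₘ (b ∈ₘ X)) ⇒ₘ (a ∈ₘ X)))

  qfFormula : ∀ {n k} → QF τ n → MSO τ n k
  qfFormula (t ≐ t')      = t ≐ₘ t'
  qfFormula (un u t)      = unₘ u t
  qfFormula (edge f t t') = edgeₘ f t t'
  qfFormula (¬q ψ)        = ¬ₘ (qfFormula ψ)
  qfFormula (ψ ∧q χ)      = qfFormula ψ ∧ₘ qfFormula χ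
  qfFormula (ψ ∨q χ)      = qfFormula ψ ∨ₘ qfFormula χ

  nbhdImplies : ∀ {n k} → Nbhd τ n → MSO τ n k → MSO τ n k
  nbhdImplies []                θ = θ
  nbhdImplies ((j , f , k) ∷ N) θ = edgeₘ f (var j) (var k) ⇒ₘ nbhdImplies N θ

  closeUniversally : ∀ {m k} → MSO τ m k → MSO τ 0 k
  closeUniversally {zero}  θ = θ
  closeUniversally {suc m} θ = closeUniversally (∀₁ θ)

  rcSentence : ReachConstraint τ → MSOSentence τ
  rcSentence (reach n c R N ψ _) =
    closeUniversally (reachFormula R (con c) (var fzero) ⇒ₘ nbhdImplies N (qfFormula ψ))

  lrpSentence : LRP τ → MSOSentence τ
  lrpSentence (rc r)   = rcSentence r
  lrpSentence (¬ₗ φ)   = ¬ₘ (lrpSentence φ)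
  lrpSentence (φ ∧ₗ χ) = lrpSentence φ ∧ₘ lrpSentence χ
  lrpSentence (φ ∨ₗ χ) = lrpSentence φ ∨ₘ lrpSentence χ

module _ {τ : Vocab} (G : Graph τ) where

  private
    ⟦_⟧_ : ∀ {m} → Term τ m → (Fin m → V G) → V G
    ⟦ t ⟧ ρ = ⟦_⟧ᵗ {G = G} t ρ

    SetEnv : ∀ k → Set₁
    SetEnv k = Fin k → (V G → Set)

    Sem : ∀ {m k} → MSO τ m k → (Fin m → V G) → SetEnv k → Set₁
    Sem θ ρ σ = ⟦_⟧ₘ {G = G} θ ρ σ

  PathW-++ : ∀ {a b c w₁ w₂} → PathW G a w₁ b → PathW G b w₂ c → PathW G a (w₁ ++ w₂) c
  PathW-++ (nil _)    q = q
  PathW-++ (step s p) q = step s (PathW-++ p q)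

  PathW-split : ∀ w₁ {w₂ a c} → PathW G a (w₁ ++ w₂) c →
                ∃[ b ] PathW G a w₁ b × PathW G b w₂ c
  PathW-split []       {a = a} p = a , nil a , p
  PathW-split (ℓ ∷ w₁) (step s p) with PathW-split w₁ p
  ... | b , p₁ , p₂ = b , step s p₁ , p₂

  RPath-∅ : ∀ {a b} → ¬ RPath G ∅ᴿ a b
  RPath-∅ (_ , () , _)

  RPath-ε : ∀ {a b} → RPath G εᴿ a b ⇔ a ≡ b
  RPath-ε = mk⇔ (λ { (_ , ε∈ , nil _) → refl }) (λ { refl → [] , ε∈ , nil _ })

  RPath-letter : ∀ ℓ {a b} → RPath G (letterExp ℓ) a b ⇔ LetterStep G a ℓ b
  RPath-letter ℓ =
    mk⇔ (λ { (_ , w∈ , p) → single w∈ p }) (λ s → [ ℓ ] , letter∈ ℓ , step s (nil _))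
    where
    letter∈ : ∀ ℓ → [ ℓ ] ∈L letterExp ℓ
    letter∈ (⟶ f)    = ⟶∈ f
    letter∈ (⟵ f)    = ⟵∈ f
    letter∈ (is u)   = u∈ u
    letter∈ (¬is u)  = ¬u∈ u
    letter∈ (isc c)  = c∈ c
    letter∈ (¬isc c) = ¬c∈ c

    ∈letter : ∀ {w} ℓ → w ∈L letterExp ℓ → w ≡ [ ℓ ]
    ∈letter (⟶ f)    (⟶∈ f)  = refl
    ∈letter (⟵ f)    (⟵∈ f)  = refl
    ∈letter (is u)   (u∈ u)  = refl
    ∈letter (¬is u)  (¬u∈ u) = refl
    ∈letter (isc c)  (c∈ c)  = refl
    ∈letter (¬isc c) (¬c∈ c) = refl

    single : ∀ {w a b} → w ∈L letterExp ℓ → PathW G a w b → LetterStep G a ℓ b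
    single w∈ p with ∈letter ℓ w∈ | p
    ... | refl | step s (nil _) = s

  RPath-· : ∀ {R₁ R₂ a c} →
            RPath G (R₁ ·ᴿ R₂) a c ⇔ (∃[ b ] RPath G R₁ a b × RPath G R₂ b c)
  RPath-· = mk⇔ split (λ { (_ , p₁ , p₂) → join p₁ p₂ })
    where
    split : ∀ {R₁ R₂ a c} → RPath G (R₁ ·ᴿ R₂) a c → ∃[ b ] RPath G R₁ a b × RPath G R₂ b c
    split (_ , ·∈ {w₁} m₁ m₂ , p) with PathW-split w₁ p
    ... | b , p₁ , p₂ = b , (_ , m₁ , p₁) , (_ , m₂ , p₂)

    join : ∀ {R₁ R₂ a b c} → RPath G R₁ a b → RPath G R₂ b c → RPath G (R₁ ·ᴿ R₂) a c
    join (w₁ , m₁ , p₁) (w₂ , m₂ , p₂) = w₁ ++ w₂ , ·∈ m₁ m₂ , PathW-++ p₁ p₂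

  RPath-∣ : ∀ {R₁ R₂ a b} → RPath G (R₁ ∣ᴿ R₂) a b ⇔ (RPath G R₁ a b ⊎ RPath G R₂ a b)
  RPath-∣ = mk⇔ (λ { (w , ∣∈ˡ m , p) → inj₁ (w , m , p) ; (w , ∣∈ʳ m , p) → inj₂ (w , m , p) })
                (λ { (inj₁ (w , m , p)) → w , ∣∈ˡ m , p ; (inj₂ (w , m , p)) → w , ∣∈ʳ m , p })

  RPath-⋆-refl : ∀ {R a} → RPath G (R ⋆ᴿ) a a
  RPath-⋆-refl = [] , ⋆∈[] , nil _

  RPath-⋆-cons : ∀ {R a b c} → RPath G R a b → RPath G (R ⋆ᴿ) b c → RPath G (R ⋆ᴿ) a c
  RPath-⋆-cons (w₁ , m₁ , p₁) (w₂ , m₂ , p₂) = w₁ ++ w₂ , ⋆∈++ m₁ m₂ , PathW-++ p₁ p₂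

  RPath-⋆-ind : ∀ {R c} (P : V G → Set) → (∀ {a b} → RPath G R a b → P b → P a) →
                P c → ∀ {a} → RPath G (R ⋆ᴿ) a c → P a
  RPath-⋆-ind {R} {c} P closed Pc (_ , w∈ , p) = go w∈ p
    where
    go : ∀ {w a} → w ∈L (R ⋆ᴿ) → PathW G a w c → P a
    go ⋆∈[]              (nil _) = Pc
    go (⋆∈++ {w₁} m₁ m₂) p with PathW-split w₁ p
    ... | _ , p₁ , p₂ = closed (w₁ , m₁ , p₁) (go m₂ p₂)

  ⟦⟧-weaken : ∀ {m} (t : Term τ m) a ρ → ⟦ weaken t ⟧ extend a ρ ≡ ⟦ t ⟧ ρ
  ⟦⟧-weaken (var i) a ρ = refl
  ⟦⟧-weaken (con c) a ρ = refl

  ⟦⟧-resp-≗ : ∀ {m} (t : Term τ m) {ρ ρ'} → ρ ≗ ρ' → ⟦ t ⟧ ρ ≡ ⟦ t ⟧ ρ'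
  ⟦⟧-resp-≗ (var i) eq = eq i
  ⟦⟧-resp-≗ (con c) eq = refl

  extend-resp-≗ : ∀ {m} a {ρ ρ' : Fin m → V G} → ρ ≗ ρ' → extend a ρ ≗ extend a ρ'
  extend-resp-≗ a eq fzero    = refl
  extend-resp-≗ a eq (fsuc i) = eq i

  extend-head-tail : ∀ {m} (ρ : Fin (suc m) → V G) → extend (ρ fzero) (λ i → ρ (fsuc i)) ≗ ρ
  extend-head-tail ρ fzero    = refl
  extend-head-tail ρ (fsuc i) = refl

  Sem-resp-≗ : ∀ {m k} (θ : MSO τ m k) {ρ ρ' σ} → ρ ≗ ρ' → Sem θ ρ σ → Sem θ ρ' σ
  Sem-resp-≗ (t ≐ₘ t') eq (lift h) =
    lift (trans (sym (⟦⟧-resp-≗ t eq)) (trans h (⟦⟧-resp-≗ t' eq)))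
  Sem-resp-≗ (unₘ u t) eq (lift h) = lift (subst (Uᴳ G u) (⟦⟧-resp-≗ t eq) h)
  Sem-resp-≗ (edgeₘ f t t') eq (lift h) =
    lift (subst₂ (E G f) (⟦⟧-resp-≗ t eq) (⟦⟧-resp-≗ t' eq) h)
  Sem-resp-≗ (t ∈ₘ X) {σ = σ} eq (lift h) = lift (subst (σ X) (⟦⟧-resp-≗ t eq) h)
  Sem-resp-≗ (¬ₘ θ)   eq h       = λ h' → h (Sem-resp-≗ θ (λ i → sym (eq i)) h')
  Sem-resp-≗ (θ ∧ₘ χ) eq (h , h') = Sem-resp-≗ θ eq h , Sem-resp-≗ χ eq h'
  Sem-resp-≗ (θ ∨ₘ χ) eq (inj₁ h) = inj₁ (Sem-resp-≗ θ eq h)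
  Sem-resp-≗ (θ ∨ₘ χ) eq (inj₂ h) = inj₂ (Sem-resp-≗ χ eq h)
  Sem-resp-≗ (θ ⇒ₘ χ) eq h       = λ h' → Sem-resp-≗ χ eq (h (Sem-resp-≗ θ (λ i → sym (eq i)) h'))
  Sem-resp-≗ (∃₁ θ)   eq (lift a , h) = lift a , Sem-resp-≗ θ (extend-resp-≗ a eq) h
  Sem-resp-≗ (∀₁ θ)   eq h       = λ a → Sem-resp-≗ θ (extend-resp-≗ a eq) (h a)
  Sem-resp-≗ (∃₂ θ)   eq (X , h) = X , Sem-resp-≗ θ eq h
  Sem-resp-≗ (∀₂ θ)   eq h       = λ X → Sem-resp-≗ θ eq (h X)

  letterFormula-correct : ∀ {m k} ℓ (x y : Term τ m) ρ (σ : SetEnv k) →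
                          Sem (letterFormula ℓ x y) ρ σ ⇔ RPath G (letterExp ℓ) (⟦ x ⟧ ρ) (⟦ y ⟧ ρ)
  letterFormula-correct ℓ x y ρ σ = ⇔-trans (atoms ℓ) (⇔-sym (RPath-letter ℓ))
    where
    atoms : ∀ ℓ → Sem (letterFormula ℓ x y) ρ σ ⇔ LetterStep G (⟦ x ⟧ ρ) ℓ (⟦ y ⟧ ρ)
    atoms (⟶ f)    = Lift-⇔
    atoms (⟵ f)    = Lift-⇔
    atoms (is u)   = Lift-⇔ ×-⇔ Lift-⇔
    atoms (¬is u)  = Lift-⇔ ×-⇔ ¬-cong-⇔ Lift-⇔
    atoms (isc c)  = Lift-⇔ ×-⇔ Lift-⇔
    atoms (¬isc c) = Lift-⇔ ×-⇔ ¬-cong-⇔ Lift-⇔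

  reachFormula-correct : ∀ {m k} R (x y : Term τ m) ρ (σ : SetEnv k) →
                         Sem (reachFormula R x y) ρ σ ⇔ RPath G R (⟦ x ⟧ ρ) (⟦ y ⟧ ρ)
  reachFormula-correct ∅ᴿ x y ρ σ =
    mk⇔ (λ h → ⊥-elim (h (lift refl))) (λ p → ⊥-elim (RPath-∅ p))
  reachFormula-correct εᴿ      x y ρ σ = ⇔-trans Lift-⇔ (⇔-sym RPath-ε)
  reachFormula-correct (⟶ᴿ f)  x y ρ σ = letterFormula-correct (⟶ f) x y ρ σ
  reachFormula-correct (⟵ᴿ f)  x y ρ σ = letterFormula-correct (⟵ f) x y ρ σ
  reachFormula-correct (uᴿ u)  x y ρ σ = letterFormula-correct (is u) x y ρ σ
  reachFormula-correct (¬uᴿ u) x y ρ σ = letterFormula-correct (¬is u) x y ρ σ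
  reachFormula-correct (cᴿ c)  x y ρ σ = letterFormula-correct (isc c) x y ρ σ
  reachFormula-correct (¬cᴿ c) x y ρ σ = letterFormula-correct (¬isc c) x y ρ σ
  reachFormula-correct (R₁ ·ᴿ R₂) x y ρ σ =
    ⇔-trans (mk⇔ (λ { (lift b , h₁ , h₂) → b , first b .to h₁ , second b .to h₂ })
                 (λ { (b , p₁ , p₂) → lift b , first b .from p₁ , second b .from p₂ }))
            (⇔-sym RPath-·)
    where
    first : ∀ b → Sem (reachFormula R₁ (weaken x) (var fzero)) (extend b ρ) σ
                  ⇔ RPath G R₁ (⟦ x ⟧ ρ) b
    first b = subst (λ a → Sem (reachFormula R₁ (weaken x) (var fzero)) (extend b ρ) σ
                           ⇔ RPath G R₁ a b)
                    (⟦⟧-weaken x b ρ)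
                    (reachFormula-correct R₁ (weaken x) (var fzero) (extend b ρ) σ)

    second : ∀ b → Sem (reachFormula R₂ (var fzero) (weaken y)) (extend b ρ) σ
                   ⇔ RPath G R₂ b (⟦ y ⟧ ρ)
    second b = subst (λ c → Sem (reachFormula R₂ (var fzero) (weaken y)) (extend b ρ) σ
                            ⇔ RPath G R₂ b c)
                     (⟦⟧-weaken y b ρ)
                     (reachFormula-correct R₂ (var fzero) (weaken y) (extend b ρ) σ)
  reachFormula-correct (R₁ ∣ᴿ R₂) x y ρ σ =
    ⇔-trans (reachFormula-correct R₁ x y ρ σ ⊎-⇔ reachFormula-correct R₂ x y ρ σ)
            (⇔-sym RPath-∣)
  reachFormula-correct (R ⋆ᴿ) x y ρ σ = mk⇔ leastClosed⇒path path⇒leastClosed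
    where
    R-step : ∀ X a b →
             Sem (reachFormula R (var (fsuc fzero)) (var fzero)) (extend b (extend a ρ)) (extend X σ)
             ⇔ RPath G R a b
    R-step X a b =
      reachFormula-correct R (var (fsuc fzero)) (var fzero) (extend b (extend a ρ)) (extend X σ)

    -- Instantiate the set variable with the set of nodes having an R*-path to y.
    leastClosed⇒path : Sem (reachFormula (R ⋆ᴿ) x y) ρ σ → RPath G (R ⋆ᴿ) (⟦ x ⟧ ρ) (⟦ y ⟧ ρ)
    leastClosed⇒path h = lower (h X (closed , lift RPath-⋆-refl))
      where
      X = λ a → RPath G (R ⋆ᴿ) a (⟦ y ⟧ ρ)
      closed = λ a b → λ { (r , lift q) → lift (RPath-⋆-cons (R-step X a b .to r) q) }

    path⇒leastClosed : RPath G (R ⋆ᴿ) (⟦ x ⟧ ρ) (⟦ y ⟧ ρ) → Sem (reachFormula (R ⋆ᴿ) x y) ρ σ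
    path⇒leastClosed p X (closed , lift Xy) = lift (RPath-⋆-ind X predecessor Xy p)
      where
      predecessor = λ {a} {b} r Xb → lower (closed a b (R-step X a b .from r , lift Xb))

  qfFormula-correct : ∀ {n k} (ψ : QF τ n) ρ (σ : SetEnv k) →
                      Sem (qfFormula ψ) ρ σ ⇔ ⟦_⟧q {G = G} ψ ρ
  qfFormula-correct (t ≐ t')      ρ σ = Lift-⇔
  qfFormula-correct (un u t)      ρ σ = Lift-⇔
  qfFormula-correct (edge f t t') ρ σ = Lift-⇔
  qfFormula-correct (¬q ψ)        ρ σ = ¬-cong-⇔ (qfFormula-correct ψ ρ σ)
  qfFormula-correct (ψ ∧q χ)      ρ σ = qfFormula-correct ψ ρ σ ×-⇔ qfFormula-correct χ ρ σ
  qfFormula-correct (ψ ∨q χ)      ρ σ = qfFormula-correct ψ ρ σ ⊎-⇔ qfFormula-correct χ ρ σ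

  nbhdImplies-correct : ∀ {n k} (N : Nbhd τ n) (θ : MSO τ n k) ρ σ →
                        Sem (nbhdImplies N θ) ρ σ ⇔ (⟦_⟧N {G = G} N ρ → Sem θ ρ σ)
  nbhdImplies-correct [] θ ρ σ = mk⇔ (λ h _ → h) (λ h → h [])
  nbhdImplies-correct ((j , f , k) ∷ N) θ ρ σ =
    mk⇔ (λ { h (e ∷ es) → IH .to (h (lift e)) es })
        (λ h (lift e) → IH .from (λ es → h (e ∷ es)))
    where IH = nbhdImplies-correct N θ ρ σ

  -- Sem-resp-≗ is needed because ρ and extend (ρ fzero) (ρ ∘ fsuc) are only pointwise equal.
  closeUniversally-correct : ∀ {m k} (θ : MSO τ m k) ρ₀ σ →
                             Sem (closeUniversally θ) ρ₀ σ ⇔ (∀ ρ → Sem θ ρ σ)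
  closeUniversally-correct {zero} θ ρ₀ σ =
    mk⇔ (λ h ρ → Sem-resp-≗ θ (λ ()) h) (λ h → h ρ₀)
  closeUniversally-correct {suc m} θ ρ₀ σ =
    ⇔-trans (closeUniversally-correct (∀₁ θ) ρ₀ σ)
            (mk⇔ (λ h ρ → Sem-resp-≗ θ (extend-head-tail ρ) (h (λ i → ρ (fsuc i)) (ρ fzero)))
                 (λ h ρ a → h (extend a ρ)))

  ⊨RC-pointwise : ∀ n c R N ψ fv →
                  G ⊨RC reach n c R N ψ fv ⇔
                  (∀ ρ → RPath G R (Cᴳ G c) (ρ fzero) → ⟦_⟧N {G = G} N ρ → ⟦_⟧q {G = G} ψ ρ)
  ⊨RC-pointwise n c R N ψ fv =
    mk⇔ (λ h ρ p → h (ρ fzero) p ρ refl) (λ { h a p ρ refl → h ρ p })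

  rcSentence-correct : ∀ r → G ⊨RC r ⇔ G ⊨ₘ rcSentence r
  rcSentence-correct (reach n c R N ψ fv) =
    ⇔-trans (⊨RC-pointwise n c R N ψ fv)
      (⇔-sym (⇔-trans (closeUniversally-correct _ (λ ()) (λ ())) (∀-cong-⇔ pointwise)))
    where
    pointwise = λ ρ →
      →-cong-⇔ (reachFormula-correct R (con c) (var fzero) ρ (λ ()))
               (⇔-trans (nbhdImplies-correct N (qfFormula ψ) ρ (λ ()))
                        (→-cong-⇔ ⇔-refl (qfFormula-correct ψ ρ (λ ()))))

  lrpSentence-correct : ∀ φ → G ⊨ φ ⇔ G ⊨ₘ lrpSentence φ
  lrpSentence-correct (rc r)   = rcSentence-correct r
  lrpSentence-correct (¬ₗ φ)   = ¬-cong-⇔ (lrpSentence-correct φ)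
  lrpSentence-correct (φ ∧ₗ χ) = lrpSentence-correct φ ×-⇔ lrpSentence-correct χ
  lrpSentence-correct (φ ∨ₗ χ) = lrpSentence-correct φ ⊎-⇔ lrpSentence-correct χ

mainTheorem11 : (τ : Vocab) (φ : LRP τ) →
    Σ (MSOSentence τ) (λ Trφ → (S : Graph τ) → (S ⊨ φ) ⇔ (S ⊨ₘ Trφ))
mainTheorem11 τ φ = lrpSentence φ , λ S → lrpSentence-correct S φ
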